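{- For any endofunctor $H$ of a category $\mathcal A$ with finite coproducts, the following are equivalent: (1) for every object $Y$ there exists a final coalgebra for the functor $H(-)+Y$; (2) there exist free completely iterative $H$-algebras on every object $Y$; (3) there exist free complete Elgot algebras on every object $Y$.
   Context: Coproduct injections are $\mathrm{inl},\mathrm{inr}$. For an $H$-algebra $\alpha:HA\to A$, a flat equation morphism in $A$ is any morphism $e:X\to HX+A$; a solution is $e^\dagger:X\to A$ with $e^\dagger=[\alpha,\mathrm{id}_A]\cdot(He^\dagger+\mathrm{id}_A)\cdot e$. A completely iterative algebra (CIA) is an $H$-algebra in which every flat equation morphism has a unique solution; a free CIA on $Y$ is a CIA $TY$ with $\eta_Y:Y\to TY$ such that each morphism from $Y$ to a CIA extends uniquely along $\eta_Y$ to an $H$-algebra homomorphism. For $e:X\to HX+Y$ and $h:Y\to Z$, $h\bullet e:=(\mathrm{id}_{HX}+h)\cdot e$; for $e:X\to HX+Y$, $f:Y\to HY+A$, $f\oplus e:=(\mathrm{can}+\mathrm{id}_A)\cdot(\mathrm{id}_{HX}+f)\cdot[e,\mathrm{inr}]$ with $\mathrm{can}=[H\mathrm{inl},H\mathrm{inr}]$. A complete Elgot algebra is an $H$-algebra with an assignment $e\mapsto e^\dagger$ of a solution to every flat equation morphism that is functorial ($e^\dagger=f^\dagger\cdot h$ whenever $(Hh+\mathrm{id}_A)\cdot e=f\cdot h$) and compositional ($(f^\dagger\bullet e)^\dagger=(f\oplus e)^\dagger\cdot\mathrm{inl}$). A morphism $h$ of complete Elgot algebras $(A,\alpha,(-)^\dagger)\to(B,\beta,(-)^\ddagger)$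 is solution-preserving if $h\cdot e^\dagger=(h\bullet e)^\ddagger$ for every flat equation morphism $e$ in $A$; a free complete Elgot algebra on $Y$ is one, $TY$ with $\eta_Y:Y\to TY$, such that every morphism $m:Y\to A$ into a complete Elgot algebra has a unique solution-preserving $h:TY\to A$ with $h\cdot\eta_Y=m$. -}

module Defs where

open import Level using (Level; _⊔_) renaming (suc to lsuc)
open import Relation.Binary using (Rel; IsEquivalence)
open import Function.Bundles using (_⇔_)
open import Data.Product using (_×_)

record Category (o ℓ e : Level) : Set (lsuc (o ⊔ ℓ ⊔ e)) where
  infix  4 _≈_ _⇒_
  infixr 9 _∘_
  field
    Obj       : Set o
    _⇒_       : Obj → Obj → Set ℓ
    _≈_       : ∀ {A B} → Rel (A ⇒ B) e
    id        : ∀ {A} → A ⇒ A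
    _∘_       : ∀ {A B C} → B ⇒ C → A ⇒ B → A ⇒ C
    assoc     : ∀ {A B C D} {f : A ⇒ B} {g : B ⇒ C} {h : C ⇒ D} →
                (h ∘ g) ∘ f ≈ h ∘ (g ∘ f)
    identityˡ : ∀ {A B} {f : A ⇒ B} → id ∘ f ≈ f
    identityʳ : ∀ {A B} {f : A ⇒ B} → f ∘ id ≈ f
    equiv     : ∀ {A B} → IsEquivalence (_≈_ {A} {B})
    ∘-resp-≈  : ∀ {A B C} {f h : B ⇒ C} {g i : A ⇒ B} →
                f ≈ h → g ≈ i → f ∘ g ≈ h ∘ i

record Endofunctor {o ℓ e} (C : Category o ℓ e) : Set (o ⊔ ℓ ⊔ e) where
  open Category C
  field
    F₀           : Obj → Obj
    F₁           : ∀ {A B} → A ⇒ B → F₀ A ⇒ F₀ B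
    identity     : ∀ {A} → F₁ (id {A}) ≈ id
    homomorphism : ∀ {A B D} {f : A ⇒ B} {g : B ⇒ D} → F₁ (g ∘ f) ≈ F₁ g ∘ F₁ f
    F-resp-≈     : ∀ {A B} {f g : A ⇒ B} → f ≈ g → F₁ f ≈ F₁ g

record Initial {o ℓ e} (C : Category o ℓ e) : Set (o ⊔ ℓ ⊔ e) where
  open Category C
  field
    ⊥        : Obj
    !        : ∀ {A} → ⊥ ⇒ A
    !-unique : ∀ {A} (f : ⊥ ⇒ A) → ! ≈ f

record BinaryCoproducts {o ℓ e} (C : Category o ℓ e) : Set (o ⊔ ℓ ⊔ e) where
  open Category C
  infixr 6 _+_
  field
    _+_     : Obj → Obj → Obj
    inl     : ∀ {A B} → A ⇒ A + B
    inr     : ∀ {A B} → B ⇒ A + B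
    [_,_]   : ∀ {A B D} → A ⇒ D → B ⇒ D → A + B ⇒ D
    inject₁ : ∀ {A B D} {f : A ⇒ D} {g : B ⇒ D} → [ f , g ] ∘ inl ≈ f
    inject₂ : ∀ {A B D} {f : A ⇒ D} {g : B ⇒ D} → [ f , g ] ∘ inr ≈ g
    unique  : ∀ {A B D} {f : A ⇒ D} {g : B ⇒ D} {h : A + B ⇒ D} →
              h ∘ inl ≈ f → h ∘ inr ≈ g → [ f , g ] ≈ h

record FiniteCoproducts {o ℓ e} (C : Category o ℓ e) : Set (o ⊔ ℓ ⊔ e) where
  field
    initial    : Initial C
    coproducts : BinaryCoproducts C

module Theory {o ℓ e} {C : Category o ℓ e}
              (FC : FiniteCoproducts C) (H : Endofunctor C) where
  open Category C
  open BinaryCoproducts (FiniteCoproducts.coproducts FC)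
  open Endofunctor H

  infixr 7 _+₁_
  _+₁_ : ∀ {A B A' B'} → A ⇒ A' → B ⇒ B' → A + B ⇒ A' + B'
  f +₁ g = [ inl ∘ f , inr ∘ g ]

  record Coalg (Y : Obj) : Set (o ⊔ ℓ) where
    field
      carrier : Obj
      str     : carrier ⇒ F₀ carrier + Y
  open Coalg

  IsCoalgHom : ∀ {Y} (c d : Coalg Y) → carrier c ⇒ carrier d → Set e
  IsCoalgHom c d h = (F₁ h +₁ id) ∘ str c ≈ str d ∘ h

  record FinalCoalgebra (Y : Obj) : Set (o ⊔ ℓ ⊔ e) where
    field
      ν        : Coalg Y
      !        : (c : Coalg Y) → carrier c ⇒ carrier ν
      !-hom    : (c : Coalg Y) → IsCoalgHom c ν (! c)
      !-unique : (c : Coalg Y) (h : carrier c ⇒ carrier ν) →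
                 IsCoalgHom c ν h → h ≈ ! c

  record Alg : Set (o ⊔ ℓ) where
    field
      A : Obj
      α : F₀ A ⇒ A
  open Alg

  IsAlgHom : (a b : Alg) → A a ⇒ A b → Set e
  IsAlgHom a b h = h ∘ α a ≈ α b ∘ F₁ h

  IsSolution : (a : Alg) {X : Obj} → X ⇒ F₀ X + A a → X ⇒ A a → Set e
  IsSolution a e s = s ≈ [ α a , id ] ∘ ((F₁ s +₁ id) ∘ e)

  record CIA : Set (o ⊔ ℓ ⊔ e) where
    field
      alg        : Alg
      sol        : ∀ {X} → X ⇒ F₀ X + A alg → X ⇒ A alg
      sol-isSol  : ∀ {X} (e : X ⇒ F₀ X + A alg) → IsSolution alg e (sol e)
      sol-unique : ∀ {X} (e : X ⇒ F₀ X + A alg) (s : X ⇒ A alg) →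
                   IsSolution alg e s → s ≈ sol e

  record FreeCIA (Y : Obj) : Set (o ⊔ ℓ ⊔ e) where
    field
      T        : CIA
      η        : Y ⇒ A (CIA.alg T)
      ext      : (B : CIA) → Y ⇒ A (CIA.alg B) → A (CIA.alg T) ⇒ A (CIA.alg B)
      ext-hom  : (B : CIA) (m : Y ⇒ A (CIA.alg B)) →
                 IsAlgHom (CIA.alg T) (CIA.alg B) (ext B m)
      ext-η    : (B : CIA) (m : Y ⇒ A (CIA.alg B)) → ext B m ∘ η ≈ m
      ext-unique : (B : CIA) (m : Y ⇒ A (CIA.alg B))
                   (h : A (CIA.alg T) ⇒ A (CIA.alg B)) →
                   IsAlgHom (CIA.alg T) (CIA.alg B) h → h ∘ η ≈ m →
                   h ≈ ext B m

  _•_ : ∀ {X Y Z} → Y ⇒ Z → X ⇒ F₀ X + Y → X ⇒ F₀ X + Z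
  h • e = (id +₁ h) ∘ e

  can : ∀ {X Y} → F₀ X + F₀ Y ⇒ F₀ (X + Y)
  can = [ F₁ inl , F₁ inr ]

  -- the associativity isomorphism HX + (HY + A) → (HX + HY) + A
  -- (left implicit in the paper's formula for ⊕)
  reassoc : ∀ {P Q R} → P + (Q + R) ⇒ (P + Q) + R
  reassoc = [ inl ∘ inl , [ inl ∘ inr , inr ] ]

  _⊕_ : ∀ {X Y B} → Y ⇒ F₀ Y + B → X ⇒ F₀ X + Y → X + Y ⇒ F₀ (X + Y) + B
  f ⊕ e = (can +₁ id) ∘ (reassoc ∘ ((id +₁ f) ∘ [ e , inr ]))

  record CompleteElgot : Set (o ⊔ ℓ ⊔ e) where
    field
      alg : Alg
      _†  : ∀ {X} → X ⇒ F₀ X + A alg → X ⇒ A alg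
      †-isSol         : ∀ {X} (e : X ⇒ F₀ X + A alg) → IsSolution alg e (e †)
      functoriality   : ∀ {X Z} (e : X ⇒ F₀ X + A alg) (f : Z ⇒ F₀ Z + A alg)
                        (h : X ⇒ Z) →
                        (F₁ h +₁ id) ∘ e ≈ f ∘ h → e † ≈ (f †) ∘ h
      compositionality : ∀ {X Y} (e : X ⇒ F₀ X + Y) (f : Y ⇒ F₀ Y + A alg) →
                         ((f †) • e) † ≈ ((f ⊕ e) †) ∘ inl

  IsSolutionPreserving : (a b : CompleteElgot) →
                         A (CompleteElgot.alg a) ⇒ A (CompleteElgot.alg b) → Set (o ⊔ ℓ ⊔ e)
  IsSolutionPreserving a b h =
    ∀ {X} (e : X ⇒ F₀ X + A (CompleteElgot.alg a)) →
    h ∘ CompleteElgot._† a e ≈ CompleteElgot._† b (h • e)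

  record FreeCompleteElgot (Y : Obj) : Set (o ⊔ ℓ ⊔ e) where
    field
      T          : CompleteElgot
      η          : Y ⇒ A (CompleteElgot.alg T)
      ext        : (B : CompleteElgot) → Y ⇒ A (CompleteElgot.alg B) →
                   A (CompleteElgot.alg T) ⇒ A (CompleteElgot.alg B)
      ext-sp     : (B : CompleteElgot) (m : Y ⇒ A (CompleteElgot.alg B)) →
                   IsSolutionPreserving T B (ext B m)
      ext-η      : (B : CompleteElgot) (m : Y ⇒ A (CompleteElgot.alg B)) →
                   ext B m ∘ η ≈ m
      ext-unique : (B : CompleteElgot) (m : Y ⇒ A (CompleteElgot.alg B))
                   (h : A (CompleteElgot.alg T) ⇒ A (CompleteElgot.alg B)) →
                   IsSolutionPreserving T B h → h ∘ η ≈ m → h ≈ ext B m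

  Cond1 : Set (o ⊔ ℓ ⊔ e)
  Cond1 = (Y : Obj) → FinalCoalgebra Y

  Cond2 : Set (o ⊔ ℓ ⊔ e)
  Cond2 = (Y : Obj) → FreeCIA Y

  Cond3 : Set (o ⊔ ℓ ⊔ e)
  Cond3 = (Y : Obj) → FreeCompleteElgot Y

{-# OPTIONS --safe #-}
module Submission where

-- The final coalgebra t : T → HT + Y is invertible (Lambek), with inverse [ τ , η ]. In the
-- algebra (T , τ), s solves a flat equation e exactly when [ s , id ] is a coalgebra homomorphism
-- from t ⊕ e to t, so finality makes (T , τ) completely iterative; and h solves m • t exactly when
-- h is a homomorphism extending m along η, so (T , τ) is the free CIA on Y. It is also the free
-- complete Elgot algebra: in an Elgot algebra B, (m • t)† preserves solutions by functoriality
-- and compositionality of B.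
-- Conversely, let T be free on Y, as a CIA or as a complete Elgot algebra. Then HT + Y with
-- structure inl · H[ τ , η ] is again such an algebra and [ τ , η ] preserves its solutions, so by
-- freeness the extension t of inr is inverse to [ τ , η ]. Coalgebra homomorphisms c → t are
-- precisely the solutions of η • c in T, and these are unique: in a CIA by definition, in a free
-- Elgot algebra because (η • t)† preserves solutions and fixes η, hence is the identity.

open import Data.Product using (_×_; _,_; proj₁; proj₂)
open import Level using (_⊔_)
open import Function.Bundles using (_⇔_; mk⇔)
open import Relation.Binary using (Setoid; IsEquivalence)
import Relation.Binary.Reasoning.Setoid as SetoidReasoning

open import Defs

module HomReasoning {o ℓ e} (C : Category o ℓ e) where
  open Category C

  hom-setoid : ∀ {A B} → Setoid ℓ e
  hom-setoid {A} {B} = record { Carrier = A ⇒ B ; _≈_ = _≈_ ; isEquivalence = equiv }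

  module _ {A B : Obj} where
    open IsEquivalence (equiv {A} {B}) public
      using () renaming (refl to ≈-refl; sym to ≈-sym; trans to ≈-trans)
    open SetoidReasoning (hom-setoid {A} {B}) public

  infixr 4 refl⟩∘⟨_
  infixl 5 _⟩∘⟨refl

  refl⟩∘⟨_ : ∀ {A B D} {f : B ⇒ D} {g i : A ⇒ B} → g ≈ i → f ∘ g ≈ f ∘ i
  refl⟩∘⟨ p = ∘-resp-≈ ≈-refl p

  _⟩∘⟨refl : ∀ {A B D} {f h : B ⇒ D} {g : A ⇒ B} → f ≈ h → f ∘ g ≈ h ∘ g
  p ⟩∘⟨refl = ∘-resp-≈ p ≈-refl

  sym-assoc : ∀ {A B D E} {f : A ⇒ B} {g : B ⇒ D} {h : D ⇒ E} → h ∘ (g ∘ f) ≈ (h ∘ g) ∘ f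
  sym-assoc = ≈-sym assoc

  pullˡ : ∀ {A B D E} {a : D ⇒ E} {b : B ⇒ D} {c : B ⇒ E} {f : A ⇒ B} →
          a ∘ b ≈ c → a ∘ (b ∘ f) ≈ c ∘ f
  pullˡ p = ≈-trans sym-assoc (p ⟩∘⟨refl)

  pullʳ : ∀ {A B D E} {a : D ⇒ E} {b : B ⇒ D} {c : A ⇒ B} {d : A ⇒ D} →
          b ∘ c ≈ d → (a ∘ b) ∘ c ≈ a ∘ d
  pullʳ p = ≈-trans assoc (refl⟩∘⟨ p)

  cancelˡ : ∀ {A B D} {h : B ⇒ D} {i : D ⇒ B} {f : A ⇒ D} → h ∘ i ≈ id → h ∘ (i ∘ f) ≈ f
  cancelˡ p = ≈-trans (pullˡ p) identityˡ

  id-comm : ∀ {A B} {f : A ⇒ B} → f ∘ id ≈ id ∘ f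
  id-comm = ≈-trans identityʳ (≈-sym identityˡ)

module _ {o ℓ e} {C : Category o ℓ e} (FC : FiniteCoproducts C) (H : Endofunctor C) where
  open Category C
  open HomReasoning C
  open BinaryCoproducts (FiniteCoproducts.coproducts FC)
  open Endofunctor H
  open Theory FC H

  -- Coproducts and flat equation morphisms

  +-η : ∀ {A B D} {h : A + B ⇒ D} → [ h ∘ inl , h ∘ inr ] ≈ h
  +-η = unique ≈-refl ≈-refl

  +-ext : ∀ {A B D} {h k : A + B ⇒ D} → h ∘ inl ≈ k ∘ inl → h ∘ inr ≈ k ∘ inr → h ≈ k
  +-ext p q = ≈-trans (≈-sym +-η) (unique (≈-sym p) (≈-sym q))

  []-cong₂ : ∀ {A B D} {f f′ : A ⇒ D} {g g′ : B ⇒ D} → f ≈ f′ → g ≈ g′ → [ f , g ] ≈ [ f′ , g′ ]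
  []-cong₂ p q = ≈-sym (unique (≈-trans inject₁ p) (≈-trans inject₂ q))

  ∘-distribˡ-[] : ∀ {A B D E} {f : A ⇒ D} {g : B ⇒ D} {h : D ⇒ E} →
                  h ∘ [ f , g ] ≈ [ h ∘ f , h ∘ g ]
  ∘-distribˡ-[] = ≈-sym (unique (pullʳ inject₁) (pullʳ inject₂))

  []∘+₁ : ∀ {A B A′ B′ D} {f : A′ ⇒ D} {g : B′ ⇒ D} {h : A ⇒ A′} {k : B ⇒ B′} →
          [ f , g ] ∘ (h +₁ k) ≈ [ f ∘ h , g ∘ k ]
  []∘+₁ = ≈-trans ∘-distribˡ-[] ([]-cong₂ (pullˡ inject₁) (pullˡ inject₂))

  +₁∘+₁ : ∀ {A B A′ B′ A″ B″} {f : A′ ⇒ A″} {g : B′ ⇒ B″} {h : A ⇒ A′} {k : B ⇒ B′} →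
          (f +₁ g) ∘ (h +₁ k) ≈ (f ∘ h) +₁ (g ∘ k)
  +₁∘+₁ = ≈-trans []∘+₁ ([]-cong₂ assoc assoc)

  +₁-cong₂ : ∀ {A B A′ B′} {f f′ : A ⇒ A′} {g g′ : B ⇒ B′} → f ≈ f′ → g ≈ g′ → f +₁ g ≈ f′ +₁ g′
  +₁-cong₂ p q = []-cong₂ (refl⟩∘⟨ p) (refl⟩∘⟨ q)

  +₁-identity : ∀ {A B} → id {A} +₁ id {B} ≈ id
  +₁-identity = +-ext (≈-trans inject₁ id-comm) (≈-trans inject₂ id-comm)

  +₁-commute : ∀ {A B A′ B′} {f : A ⇒ A′} {g : B ⇒ B′} →
               (f +₁ id) ∘ (id +₁ g) ≈ (id +₁ g) ∘ (f +₁ id)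
  +₁-commute = ≈-trans +₁∘+₁ (≈-trans (+₁-cong₂ id-comm (≈-sym id-comm)) (≈-sym +₁∘+₁))

  F₁+₁-identity : ∀ {A Y} {h : A ⇒ A} → h ≈ id → F₁ h +₁ id {Y} ≈ id
  F₁+₁-identity p = ≈-trans (+₁-cong₂ (≈-trans (F-resp-≈ p) identity) ≈-refl) +₁-identity

  F₁+₁-homomorphism : ∀ {A B D Y} {f : B ⇒ D} {g : A ⇒ B} →
                      (F₁ f +₁ id {Y}) ∘ (F₁ g +₁ id) ≈ F₁ (f ∘ g) +₁ id
  F₁+₁-homomorphism = ≈-trans +₁∘+₁ (+₁-cong₂ (≈-sym homomorphism) identityˡ)

  •-cong : ∀ {X Y Z} {f g : Y ⇒ Z} {c : X ⇒ F₀ X + Y} → f ≈ g → f • c ≈ g • c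
  •-cong p = +₁-cong₂ ≈-refl p ⟩∘⟨refl

  •-∘ : ∀ {X Y Z W} {f : Z ⇒ W} {g : Y ⇒ Z} {c : X ⇒ F₀ X + Y} → f • (g • c) ≈ (f ∘ g) • c
  •-∘ = pullˡ (≈-trans +₁∘+₁ (+₁-cong₂ identityˡ ≈-refl))

  •-commute : ∀ {X W Y Z} {f : F₀ X ⇒ W} {m : Y ⇒ Z} {c : X ⇒ F₀ X + Y} →
              (id +₁ m) ∘ (f +₁ id) ∘ c ≈ (f +₁ id) ∘ (id +₁ m) ∘ c
  •-commute = ≈-trans sym-assoc (≈-trans (≈-sym +₁-commute ⟩∘⟨refl) assoc)

  •-natural : ∀ {X X′ Y Z} {h : X ⇒ X′} {m : Y ⇒ Z} {c : X ⇒ F₀ X + Y} {d : X′ ⇒ F₀ X′ + Y} →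
              (F₁ h +₁ id) ∘ c ≈ d ∘ h → (F₁ h +₁ id) ∘ (m • c) ≈ (m • d) ∘ h
  •-natural p = ≈-trans (≈-sym •-commute) (≈-trans (refl⟩∘⟨ p) sym-assoc)

  solution-rhs : ∀ {A B X W} {β : F₀ A ⇒ B} {s : X ⇒ A} {c : W ⇒ F₀ X + B} →
                 [ β , id ] ∘ (F₁ s +₁ id) ∘ c ≈ [ β ∘ F₁ s , id ] ∘ c
  solution-rhs = pullˡ (≈-trans []∘+₁ ([]-cong₂ ≈-refl identityʳ))

  solution-rhs-• : ∀ {A B X Y} {β : F₀ A ⇒ B} {s : X ⇒ A} {m : Y ⇒ B} {c : X ⇒ F₀ X + Y} →
                   [ β , id ] ∘ (F₁ s +₁ id) ∘ (m • c) ≈ [ β ∘ F₁ s , m ] ∘ c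
  solution-rhs-• = ≈-trans solution-rhs (pullˡ (≈-trans []∘+₁ ([]-cong₂ identityʳ identityˡ)))

  -- Its solution is [ α ∘ F₁ k , k ]; for k = id this presents the algebra structure α as a solution.
  algebra-equation : ∀ {Z B} → Z ⇒ B → F₀ Z + Z ⇒ F₀ (F₀ Z + Z) + B
  algebra-equation k = [ inl ∘ F₁ inr , inr ∘ k ]

  algebra-equation-solution : (a : Alg) {Z : Obj} {k : Z ⇒ Alg.A a} {s : F₀ Z + Z ⇒ Alg.A a} →
                              IsSolution a (algebra-equation k) s → s ≈ [ Alg.α a ∘ F₁ k , k ]
  algebra-equation-solution a {k = k} {s} p =
    ≈-trans unfolded ([]-cong₂ (refl⟩∘⟨ F-resp-≈ s∘inr≈k) ≈-refl)
    where
      α : F₀ (Alg.A a) ⇒ Alg.A a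
      α = Alg.α a
      unfolded : s ≈ [ α ∘ F₁ (s ∘ inr) , k ]
      unfolded = begin
        s                                                   ≈⟨ ≈-trans p solution-rhs ⟩
        [ α ∘ F₁ s , id ] ∘ [ inl ∘ F₁ inr , inr ∘ k ]      ≈⟨ ∘-distribˡ-[] ⟩
        [ [ α ∘ F₁ s , id ] ∘ inl ∘ F₁ inr , [ α ∘ F₁ s , id ] ∘ inr ∘ k ]
          ≈⟨ []-cong₂ (pullˡ inject₁) (pullˡ inject₂) ⟩
        [ (α ∘ F₁ s) ∘ F₁ inr , id ∘ k ]                    ≈⟨ []-cong₂ (pullʳ (≈-sym homomorphism)) identityˡ ⟩
        [ α ∘ F₁ (s ∘ inr) , k ]                            ∎
      s∘inr≈k : s ∘ inr ≈ k
      s∘inr≈k = ≈-trans (unfolded ⟩∘⟨refl) inject₂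

  ⊕-factor : ∀ {X Y B} {f : Y ⇒ F₀ Y + B} {c : X ⇒ F₀ X + Y} →
             f ⊕ c ≈ [ inl ∘ F₁ inl , (F₁ inr +₁ id) ∘ f ] ∘ [ c , inr ]
  ⊕-factor = ≈-trans (refl⟩∘⟨ sym-assoc) (≈-trans sym-assoc (core ⟩∘⟨refl))
    where
      can+₁id∘reassoc : ∀ {X Y B} →
        (can {X} {Y} +₁ id {B}) ∘ reassoc ≈ [ inl ∘ F₁ inl , F₁ inr +₁ id ]
      can+₁id∘reassoc = ≈-trans ∘-distribˡ-[]
        ([]-cong₂ (≈-trans (pullˡ inject₁) (pullʳ inject₁))
                  (≈-trans ∘-distribˡ-[] ([]-cong₂ (≈-trans (pullˡ inject₁) (pullʳ inject₂)) inject₂)))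
      core : ∀ {X Y B} {f : Y ⇒ F₀ Y + B} →
             (can +₁ id) ∘ reassoc ∘ (id {F₀ X} +₁ f) ≈ [ inl ∘ F₁ inl , (F₁ inr +₁ id) ∘ f ]
      core = ≈-trans (pullˡ can+₁id∘reassoc) (≈-trans []∘+₁ ([]-cong₂ identityʳ ≈-refl))

  ⊕-inl : ∀ {X Y B} {f : Y ⇒ F₀ Y + B} {c : X ⇒ F₀ X + Y} →
          (f ⊕ c) ∘ inl ≈ [ inl ∘ F₁ inl , (F₁ inr +₁ id) ∘ f ] ∘ c
  ⊕-inl = ≈-trans (⊕-factor ⟩∘⟨refl) (pullʳ inject₁)

  ⊕-inr : ∀ {X Y B} {f : Y ⇒ F₀ Y + B} {c : X ⇒ F₀ X + Y} →
          (f ⊕ c) ∘ inr ≈ (F₁ inr +₁ id) ∘ f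
  ⊕-inr = ≈-trans (⊕-factor ⟩∘⟨refl) (≈-trans (pullʳ inject₂) inject₂)

  F₁+₁∘⊕-inl : ∀ {X Y B D} {f : Y ⇒ F₀ Y + B} {c : X ⇒ F₀ X + Y} {h : X + Y ⇒ D} →
               (F₁ h +₁ id) ∘ (f ⊕ c) ∘ inl ≈ [ inl ∘ F₁ (h ∘ inl) , (F₁ (h ∘ inr) +₁ id) ∘ f ] ∘ c
  F₁+₁∘⊕-inl = ≈-trans (refl⟩∘⟨ ⊕-inl) (pullˡ (≈-trans ∘-distribˡ-[]
    ([]-cong₂ (≈-trans (pullˡ inject₁) (pullʳ (≈-sym homomorphism))) (pullˡ F₁+₁-homomorphism))))

  F₁+₁∘⊕-inr : ∀ {X Y B D} {f : Y ⇒ F₀ Y + B} {c : X ⇒ F₀ X + Y} {h : X + Y ⇒ D} →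
               (F₁ h +₁ id) ∘ (f ⊕ c) ∘ inr ≈ (F₁ (h ∘ inr) +₁ id) ∘ f
  F₁+₁∘⊕-inr = ≈-trans (refl⟩∘⟨ ⊕-inr) (pullˡ F₁+₁-homomorphism)

  ⊕-• : ∀ {X Y B D} {m : B ⇒ D} {f : Y ⇒ F₀ Y + B} {c : X ⇒ F₀ X + Y} →
        (m • f) ⊕ c ≈ m • (f ⊕ c)
  ⊕-• = +-ext
    (≈-trans ⊕-inl (≈-sym (≈-trans (pullʳ ⊕-inl) (pullˡ (≈-trans ∘-distribˡ-[]
      ([]-cong₂ (≈-trans (pullˡ inject₁) (pullʳ identityˡ)) •-commute))))))
    (≈-trans ⊕-inr (≈-sym (≈-trans (pullʳ ⊕-inr) •-commute)))

  solution-rhs-⊕-inl : ∀ {A X Y D} {β : F₀ A ⇒ D} {S : X + Y ⇒ A} {f : Y ⇒ F₀ Y + D} {c : X ⇒ F₀ X + Y} →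
    [ β , id ] ∘ (F₁ S +₁ id) ∘ (f ⊕ c) ∘ inl ≈ [ β ∘ F₁ (S ∘ inl) , [ β , id ] ∘ (F₁ (S ∘ inr) +₁ id) ∘ f ] ∘ c
  solution-rhs-⊕-inl =
    ≈-trans (refl⟩∘⟨ F₁+₁∘⊕-inl) (pullˡ (≈-trans ∘-distribˡ-[] ([]-cong₂ (pullˡ inject₁) ≈-refl)))

  •-identity : ∀ {X Y} {c : X ⇒ F₀ X + Y} → id • c ≈ c
  •-identity = ≈-trans (+₁-identity ⟩∘⟨refl) identityˡ

  •-algebra-equation : ∀ {Z B D} {h : B ⇒ D} {k : Z ⇒ B} → h • algebra-equation k ≈ algebra-equation (h ∘ k)
  •-algebra-equation = ≈-trans ∘-distribˡ-[]
    ([]-cong₂ (≈-trans (pullˡ inject₁) (pullʳ identityˡ)) (≈-trans (pullˡ inject₂) assoc))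

  id-homomorphism : (a : Alg) → IsAlgHom a a id
  id-homomorphism a = ≈-trans identityˡ (≈-sym (≈-trans (refl⟩∘⟨ identity) identityʳ))

  ∘-homomorphism : (a b c : Alg) {g : Alg.A b ⇒ Alg.A c} {h : Alg.A a ⇒ Alg.A b} →
                   IsAlgHom b c g → IsAlgHom a b h → IsAlgHom a c (g ∘ h)
  ∘-homomorphism a b c {g} {h} g-hom h-hom = begin
    (g ∘ h) ∘ Alg.α a          ≈⟨ pullʳ h-hom ⟩
    g ∘ Alg.α b ∘ F₁ h         ≈⟨ pullˡ g-hom ⟩
    (Alg.α c ∘ F₁ g) ∘ F₁ h    ≈⟨ pullʳ (≈-sym homomorphism) ⟩
    Alg.α c ∘ F₁ (g ∘ h)       ∎

  -- Complete Elgot algebras and completely iterative algebras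

  Carrier : CompleteElgot → Obj
  Carrier B = Alg.A (CompleteElgot.alg B)

  module ElgotLaws (B : CompleteElgot) where
    open CompleteElgot B

    †-cong : ∀ {X} {c d : X ⇒ F₀ X + Alg.A alg} → c ≈ d → c † ≈ d †
    †-cong p = ≈-trans (functoriality _ _ id (≈-trans (F₁+₁-identity ≈-refl ⟩∘⟨refl)
                                               (≈-trans identityˡ (≈-trans p (≈-sym identityʳ)))))
                       identityʳ

    †-•-natural : ∀ {X X′ Y} {h : X ⇒ X′} {m : Y ⇒ Alg.A alg} {c : X ⇒ F₀ X + Y} {d : X′ ⇒ F₀ X′ + Y} →
                  (F₁ h +₁ id) ∘ c ≈ d ∘ h → (m • c) † ≈ ((m • d) †) ∘ h
    †-•-natural p = functoriality _ _ _ (•-natural p)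

    †-algebra-equation-inl : ∀ {Z} {k : Z ⇒ Alg.A alg} → (algebra-equation k †) ∘ inl ≈ Alg.α alg ∘ F₁ k
    †-algebra-equation-inl = ≈-trans (algebra-equation-solution alg (†-isSol _) ⟩∘⟨refl) inject₁

  module _ (A B : CompleteElgot) where
    private
      module A = CompleteElgot A
      module B = CompleteElgot B

    solution-preserving⇒homomorphism : ∀ {h} → IsSolutionPreserving A B h → IsAlgHom A.alg B.alg h
    solution-preserving⇒homomorphism {h} sp = begin
      h ∘ Alg.α A.alg                               ≈⟨ refl⟩∘⟨ α-as-solution ⟨
      h ∘ (algebra-equation id A.†) ∘ inl           ≈⟨ sym-assoc ⟩
      (h ∘ (algebra-equation id A.†)) ∘ inl         ≈⟨ sp _ ⟩∘⟨refl ⟩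
      ((h • algebra-equation id) B.†) ∘ inl         ≈⟨ ElgotLaws.†-cong B •-algebra-equation ⟩∘⟨refl ⟩
      (algebra-equation (h ∘ id) B.†) ∘ inl         ≈⟨ ElgotLaws.†-algebra-equation-inl B ⟩
      Alg.α B.alg ∘ F₁ (h ∘ id)                     ≈⟨ refl⟩∘⟨ F-resp-≈ identityʳ ⟩
      Alg.α B.alg ∘ F₁ h                            ∎
      where
        α-as-solution : (algebra-equation id A.†) ∘ inl ≈ Alg.α A.alg
        α-as-solution = ≈-trans (ElgotLaws.†-algebra-equation-inl A) (≈-trans (refl⟩∘⟨ identity) identityʳ)

  id-preserves-solutions : (A : CompleteElgot) → IsSolutionPreserving A A id
  id-preserves-solutions A c = ≈-trans identityˡ (ElgotLaws.†-cong A (≈-sym •-identity))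

  ∘-preserves-solutions : (A B D : CompleteElgot) {g : Carrier B ⇒ Carrier D} {h : Carrier A ⇒ Carrier B} →
                          IsSolutionPreserving B D g → IsSolutionPreserving A B h →
                          IsSolutionPreserving A D (g ∘ h)
  ∘-preserves-solutions A B D g-sp h-sp c =
    ≈-trans assoc (≈-trans (refl⟩∘⟨ h-sp c) (≈-trans (g-sp _) (ElgotLaws.†-cong D •-∘)))

  module CIALaws (B : CIA) where
    open CIA B
    private
      α : F₀ (Alg.A alg) ⇒ Alg.A alg
      α = Alg.α alg

    sol-functorial : ∀ {X X′} {c : X ⇒ F₀ X + Alg.A alg} {d : X′ ⇒ F₀ X′ + Alg.A alg} {h : X ⇒ X′} →
                     (F₁ h +₁ id) ∘ c ≈ d ∘ h → sol c ≈ sol d ∘ h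
    sol-functorial {c = c} {d} {h} p = ≈-sym (sol-unique c (sol d ∘ h) (begin
      sol d ∘ h                                            ≈⟨ sol-isSol d ⟩∘⟨refl ⟩
      ([ α , id ] ∘ (F₁ (sol d) +₁ id) ∘ d) ∘ h            ≈⟨ ≈-trans assoc (refl⟩∘⟨ assoc) ⟩
      [ α , id ] ∘ (F₁ (sol d) +₁ id) ∘ d ∘ h              ≈⟨ refl⟩∘⟨ refl⟩∘⟨ p ⟨
      [ α , id ] ∘ (F₁ (sol d) +₁ id) ∘ (F₁ h +₁ id) ∘ c   ≈⟨ refl⟩∘⟨ pullˡ F₁+₁-homomorphism ⟩
      [ α , id ] ∘ (F₁ (sol d ∘ h) +₁ id) ∘ c              ∎))

    sol-compositional : ∀ {X Y} (c : X ⇒ F₀ X + Y) (f : Y ⇒ F₀ Y + Alg.A alg) →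
                        sol (sol f • c) ≈ sol (f ⊕ c) ∘ inl
    sol-compositional {X} {Y} c f = ≈-sym (sol-unique _ (S ∘ inl) (begin
      S ∘ inl                                                    ≈⟨ sol-isSol (f ⊕ c) ⟩∘⟨refl ⟩
      ([ α , id ] ∘ (F₁ S +₁ id) ∘ (f ⊕ c)) ∘ inl                ≈⟨ ≈-trans assoc (refl⟩∘⟨ assoc) ⟩
      [ α , id ] ∘ (F₁ S +₁ id) ∘ (f ⊕ c) ∘ inl                  ≈⟨ solution-rhs-⊕-inl ⟩
      [ α ∘ F₁ (S ∘ inl) , [ α , id ] ∘ (F₁ (S ∘ inr) +₁ id) ∘ f ] ∘ c
        ≈⟨ []-cong₂ ≈-refl S∘inr-solves-f ⟩∘⟨refl ⟩
      [ α ∘ F₁ (S ∘ inl) , sol f ] ∘ c                            ≈⟨ solution-rhs-• ⟨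
      [ α , id ] ∘ (F₁ (S ∘ inl) +₁ id) ∘ (sol f • c)             ∎))
      where
        S : X + Y ⇒ Alg.A alg
        S = sol (f ⊕ c)
        S∘inr≈sol-f : S ∘ inr ≈ sol f
        S∘inr≈sol-f = ≈-sym (sol-functorial (≈-sym ⊕-inr))
        S∘inr-solves-f : [ α , id ] ∘ (F₁ (S ∘ inr) +₁ id) ∘ f ≈ sol f
        S∘inr-solves-f = ≈-trans (refl⟩∘⟨ +₁-cong₂ (F-resp-≈ S∘inr≈sol-f) ≈-refl ⟩∘⟨refl) (≈-sym (sol-isSol f))

  CIA⇒CompleteElgot : CIA → CompleteElgot
  CIA⇒CompleteElgot B = record
    { alg              = CIA.alg B
    ; _†               = CIA.sol B
    ; †-isSol          = CIA.sol-isSol B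
    ; functoriality    = λ _ _ _ → CIALaws.sol-functorial B
    ; compositionality = CIALaws.sol-compositional B
    }

  -- Fixed points T ≅ HT + Y

  record Unfolding (Y : Obj) : Set (o ⊔ ℓ ⊔ e) where
    field
      T    : Obj
      τ    : F₀ T ⇒ T
      η    : Y ⇒ T
      t    : T ⇒ F₀ T + Y
      isoˡ : [ τ , η ] ∘ t ≈ id
      isoʳ : t ∘ [ τ , η ] ≈ id

  module UnfoldingProperties {Y : Obj} (U : Unfolding Y) where
    open Unfolding U

    algebra : Alg
    algebra = record { A = T ; α = τ }

    t∘τ≈inl : t ∘ τ ≈ inl
    t∘τ≈inl = ≈-trans (refl⟩∘⟨ ≈-sym inject₁) (cancelˡ isoʳ)

    t∘η≈inr : t ∘ η ≈ inr
    t∘η≈inr = ≈-trans (refl⟩∘⟨ ≈-sym inject₂) (cancelˡ isoʳ)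

    solution⇒coalgebraic : ∀ {X} {c : X ⇒ F₀ X + T} {s : X ⇒ T} →
                           IsSolution algebra c s → t ∘ s ≈ [ inl ∘ F₁ s , t ] ∘ c
    solution⇒coalgebraic p = ≈-trans (refl⟩∘⟨ ≈-trans p solution-rhs)
      (pullˡ (≈-trans ∘-distribˡ-[] ([]-cong₂ (pullˡ t∘τ≈inl) identityʳ)))

    coalgebraic⇒solution : ∀ {X} {c : X ⇒ F₀ X + T} {s : X ⇒ T} →
                           t ∘ s ≈ [ inl ∘ F₁ s , t ] ∘ c → IsSolution algebra c s
    coalgebraic⇒solution {c = c} {s} p = begin
      s                                              ≈⟨ cancelˡ isoˡ ⟨
      [ τ , η ] ∘ t ∘ s                              ≈⟨ refl⟩∘⟨ p ⟩
      [ τ , η ] ∘ [ inl ∘ F₁ s , t ] ∘ c             ≈⟨ pullˡ ∘-distribˡ-[] ⟩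
      [ [ τ , η ] ∘ inl ∘ F₁ s , [ τ , η ] ∘ t ] ∘ c ≈⟨ []-cong₂ (pullˡ inject₁) isoˡ ⟩∘⟨refl ⟩
      [ τ ∘ F₁ s , id ] ∘ c                          ≈⟨ solution-rhs ⟨
      [ τ , id ] ∘ (F₁ s +₁ id) ∘ c                  ∎

    F₁+₁∘t⊕-inl : ∀ {X} {c : X ⇒ F₀ X + T} {h : X + T ⇒ T} → h ∘ inr ≈ id →
                  (F₁ h +₁ id) ∘ (t ⊕ c) ∘ inl ≈ [ inl ∘ F₁ (h ∘ inl) , t ] ∘ c
    F₁+₁∘t⊕-inl p = ≈-trans F₁+₁∘⊕-inl ([]-cong₂ ≈-refl (≈-trans (F₁+₁-identity p ⟩∘⟨refl) identityˡ) ⟩∘⟨refl)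

    solution⇒⊕-homomorphism : ∀ {X} {c : X ⇒ F₀ X + T} {s : X ⇒ T} →
                              IsSolution algebra c s → (F₁ [ s , id ] +₁ id) ∘ (t ⊕ c) ≈ t ∘ [ s , id ]
    solution⇒⊕-homomorphism {s = s} p = +-ext
      (begin
        ((F₁ [ s , id ] +₁ id) ∘ (t ⊕ _)) ∘ inl    ≈⟨ assoc ⟩
        (F₁ [ s , id ] +₁ id) ∘ (t ⊕ _) ∘ inl      ≈⟨ F₁+₁∘t⊕-inl inject₂ ⟩
        [ inl ∘ F₁ ([ s , id ] ∘ inl) , t ] ∘ _    ≈⟨ []-cong₂ (refl⟩∘⟨ F-resp-≈ inject₁) ≈-refl ⟩∘⟨refl ⟩
        [ inl ∘ F₁ s , t ] ∘ _                     ≈⟨ solution⇒coalgebraic p ⟨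
        t ∘ s                                      ≈⟨ pullʳ inject₁ ⟨
        (t ∘ [ s , id ]) ∘ inl                     ∎)
      (begin
        ((F₁ [ s , id ] +₁ id) ∘ (t ⊕ _)) ∘ inr    ≈⟨ assoc ⟩
        (F₁ [ s , id ] +₁ id) ∘ (t ⊕ _) ∘ inr      ≈⟨ F₁+₁∘⊕-inr ⟩
        (F₁ ([ s , id ] ∘ inr) +₁ id) ∘ t          ≈⟨ ≈-trans (F₁+₁-identity inject₂ ⟩∘⟨refl) (≈-sym id-comm) ⟩
        t ∘ id                                     ≈⟨ pullʳ inject₂ ⟨
        (t ∘ [ s , id ]) ∘ inr                     ∎)

    ⊕-homomorphism⇒solution : ∀ {X} {c : X ⇒ F₀ X + T} {h : X + T ⇒ T} →
                              (F₁ h +₁ id) ∘ (t ⊕ c) ≈ t ∘ h → h ∘ inr ≈ id → IsSolution algebra c (h ∘ inl)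
    ⊕-homomorphism⇒solution hom h∘inr≈id = coalgebraic⇒solution
      (≈-trans sym-assoc (≈-trans (≈-sym hom ⟩∘⟨refl) (≈-trans assoc (F₁+₁∘t⊕-inl h∘inr≈id))))

    module _ (b : Alg) {m : Y ⇒ Alg.A b} {h : T ⇒ Alg.A b} where
      private
        β : F₀ (Alg.A b) ⇒ Alg.A b
        β = Alg.α b

      solution⇒extension : IsSolution b (m • t) h → IsAlgHom algebra b h × h ∘ η ≈ m
      solution⇒extension p =
        ≈-trans (h≈ ⟩∘⟨refl) (≈-trans (pullʳ t∘τ≈inl) inject₁) ,
        ≈-trans (h≈ ⟩∘⟨refl) (≈-trans (pullʳ t∘η≈inr) inject₂)
        where
          h≈ : h ≈ [ β ∘ F₁ h , m ] ∘ t
          h≈ = ≈-trans p solution-rhs-•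

      extension⇒solution : IsAlgHom algebra b h → h ∘ η ≈ m → IsSolution b (m • t) h
      extension⇒solution hom h∘η≈m = begin
        h                                    ≈⟨ ≈-trans (refl⟩∘⟨ isoˡ) identityʳ ⟨
        h ∘ [ τ , η ] ∘ t                    ≈⟨ pullˡ (≈-trans ∘-distribˡ-[] ([]-cong₂ hom h∘η≈m)) ⟩
        [ β ∘ F₁ h , m ] ∘ t                 ≈⟨ solution-rhs-• ⟨
        [ β , id ] ∘ (F₁ h +₁ id) ∘ (m • t)  ∎

    private
      η•-rhs : ∀ {X} {c : X ⇒ F₀ X + Y} {h : X ⇒ T} →
               [ τ , id ] ∘ (F₁ h +₁ id) ∘ (η • c) ≈ [ τ , η ] ∘ (F₁ h +₁ id) ∘ c
      η•-rhs = ≈-trans solution-rhs-• (≈-sym (pullˡ (≈-trans []∘+₁ ([]-cong₂ ≈-refl identityʳ))))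

    coalgebra-homomorphism⇒solution : ∀ {X} {c : X ⇒ F₀ X + Y} {h : X ⇒ T} →
                                      (F₁ h +₁ id) ∘ c ≈ t ∘ h → IsSolution algebra (η • c) h
    coalgebra-homomorphism⇒solution hom =
      ≈-trans (≈-sym (cancelˡ isoˡ)) (≈-trans (refl⟩∘⟨ ≈-sym hom) (≈-sym η•-rhs))

    solution⇒coalgebra-homomorphism : ∀ {X} {c : X ⇒ F₀ X + Y} {h : X ⇒ T} →
                                      IsSolution algebra (η • c) h → (F₁ h +₁ id) ∘ c ≈ t ∘ h
    solution⇒coalgebra-homomorphism p = ≈-sym (≈-trans (refl⟩∘⟨ ≈-trans p η•-rhs) (cancelˡ isoʳ))

    final : (sol : ∀ {X} → X ⇒ F₀ X + T → X ⇒ T) →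
            (∀ {X} (c : X ⇒ F₀ X + T) → IsSolution algebra c (sol c)) →
            (∀ {X} (c : X ⇒ F₀ X + Y) (h : X ⇒ T) → IsSolution algebra (η • c) h → h ≈ sol (η • c)) →
            FinalCoalgebra Y
    final sol sol-isSol sol-unique = record
      { ν        = record { carrier = T ; str = t }
      ; !        = λ c → sol (η • Coalg.str c)
      ; !-hom    = λ c → solution⇒coalgebra-homomorphism (sol-isSol _)
      ; !-unique = λ c h hom → sol-unique (Coalg.str c) h (coalgebra-homomorphism⇒solution hom)
      }

    extension-preserves-solutions :
      (B : CompleteElgot) (m : Y ⇒ Carrier B) {X : Obj} {c : X ⇒ F₀ X + T} {s : X ⇒ T} →
      let open CompleteElgot B in IsSolution algebra c s → ((m • t) †) ∘ s ≈ (((m • t) †) • c) †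
    extension-preserves-solutions B m {c = c} {s} p = begin
      ((m • t) †) ∘ s                   ≈⟨ refl⟩∘⟨ inject₁ ⟨
      ((m • t) †) ∘ [ s , id ] ∘ inl    ≈⟨ sym-assoc ⟩
      (((m • t) †) ∘ [ s , id ]) ∘ inl  ≈⟨ †-•-natural (solution⇒⊕-homomorphism p) ⟩∘⟨refl ⟨
      ((m • (t ⊕ c)) †) ∘ inl           ≈⟨ †-cong ⊕-• ⟩∘⟨refl ⟨
      (((m • t) ⊕ c) †) ∘ inl           ≈⟨ compositionality c (m • t) ⟨
      (((m • t) †) • c) †               ∎
      where
        open CompleteElgot B
        open ElgotLaws B

    module _ (sol : ∀ {X} → X ⇒ F₀ X + T → X ⇒ T)
             (sol-isSol : ∀ {X} (c : X ⇒ F₀ X + T) → IsSolution algebra c (sol c))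
             (sol-unique : ∀ {X} (c : X ⇒ F₀ X + T) (s : X ⇒ T) → IsSolution algebra c s → s ≈ sol c) where

      cia : CIA
      cia = record { alg = algebra ; sol = sol ; sol-isSol = sol-isSol ; sol-unique = sol-unique }

      free-cia : FreeCIA Y
      free-cia = record
        { T          = cia
        ; η          = η
        ; ext        = λ B m → CIA.sol B (m • t)
        ; ext-hom    = λ B m → proj₁ (solution⇒extension (CIA.alg B) (CIA.sol-isSol B _))
        ; ext-η      = λ B m → proj₂ (solution⇒extension (CIA.alg B) (CIA.sol-isSol B _))
        ; ext-unique = λ B m h hom h∘η≈m → CIA.sol-unique B _ h (extension⇒solution (CIA.alg B) hom h∘η≈m)
        }

      sol-η•t≈id : sol (η • t) ≈ id
      sol-η•t≈id = ≈-sym (sol-unique _ id (extension⇒solution algebra (id-homomorphism algebra) identityˡ))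

      solution-preserving-extension-unique :
        (B : CompleteElgot) {m : Y ⇒ Carrier B} {h : T ⇒ Carrier B} →
        let open CompleteElgot B in IsSolutionPreserving (CIA⇒CompleteElgot cia) B h → h ∘ η ≈ m → h ≈ (m • t) †
      solution-preserving-extension-unique B {m} {h} sp h∘η≈m = begin
        h                  ≈⟨ ≈-trans (refl⟩∘⟨ sol-η•t≈id) identityʳ ⟨
        h ∘ sol (η • t)    ≈⟨ sp (η • t) ⟩
        (h • (η • t)) †    ≈⟨ †-cong (≈-trans •-∘ (•-cong h∘η≈m)) ⟩
        (m • t) †          ∎
        where
          open CompleteElgot B
          open ElgotLaws B

      free-complete-elgot : FreeCompleteElgot Y
      free-complete-elgot = record
        { T          = CIA⇒CompleteElgot cia
        ; η          = η
        ; ext        = λ B m → CompleteElgot._† B (m • t)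
        ; ext-sp     = λ B m c → extension-preserves-solutions B m (sol-isSol c)
        ; ext-η      = λ B m → proj₂ (solution⇒extension (CompleteElgot.alg B) (CompleteElgot.†-isSol B _))
        ; ext-unique = λ B m h → solution-preserving-extension-unique B
        }

  module FinalCoalgebraProperties {Y : Obj} (F : FinalCoalgebra Y) where
    open FinalCoalgebra F
    private
      T : Obj
      T = Coalg.carrier ν
      t : T ⇒ F₀ T + Y
      t = Coalg.str ν

    endomorphism≈id : {h : T ⇒ T} → IsCoalgHom ν ν h → h ≈ id
    endomorphism≈id hom = ≈-trans (!-unique ν _ hom)
      (≈-sym (!-unique ν id (≈-trans (F₁+₁-identity ≈-refl ⟩∘⟨refl) (≈-sym id-comm))))

    lambek : Unfolding Y
    lambek = record
      { T    = T
      ; τ    = fold ∘ inl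
      ; η    = fold ∘ inr
      ; t    = t
      ; isoˡ = ≈-trans (+-η ⟩∘⟨refl) fold∘t≈id
      ; isoʳ = ≈-trans (refl⟩∘⟨ +-η) t∘fold≈id
      }
      where
        F₁t+₁id : Coalg Y
        F₁t+₁id = record { carrier = F₀ T + Y ; str = F₁ t +₁ id }
        fold : F₀ T + Y ⇒ T
        fold = ! F₁t+₁id
        fold∘t≈id : fold ∘ t ≈ id
        fold∘t≈id = endomorphism≈id (begin
          (F₁ (fold ∘ t) +₁ id) ∘ t                ≈⟨ F₁+₁-homomorphism ⟩∘⟨refl ⟨
          ((F₁ fold +₁ id) ∘ (F₁ t +₁ id)) ∘ t     ≈⟨ !-hom F₁t+₁id ⟩∘⟨refl ⟩
          (t ∘ fold) ∘ t                           ≈⟨ assoc ⟩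
          t ∘ fold ∘ t                             ∎)
        t∘fold≈id : t ∘ fold ≈ id
        t∘fold≈id = ≈-trans (≈-sym (!-hom F₁t+₁id)) (≈-trans F₁+₁-homomorphism (F₁+₁-identity fold∘t≈id))

    open UnfoldingProperties lambek

    module _ {X : Obj} (c : X ⇒ F₀ X + T) where
      private
        ⊕-coalgebra : Coalg Y
        ⊕-coalgebra = record { carrier = X + T ; str = t ⊕ c }
        h : X + T ⇒ T
        h = ! ⊕-coalgebra

        h∘inr≈id : h ∘ inr ≈ id
        h∘inr≈id = endomorphism≈id (begin
          (F₁ (h ∘ inr) +₁ id) ∘ t     ≈⟨ F₁+₁∘⊕-inr ⟨
          (F₁ h +₁ id) ∘ (t ⊕ c) ∘ inr  ≈⟨ pullˡ (!-hom ⊕-coalgebra) ⟩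
          (t ∘ h) ∘ inr                 ≈⟨ assoc ⟩
          t ∘ h ∘ inr                   ∎)

      solution : X ⇒ T
      solution = h ∘ inl

      solution-isSol : IsSolution algebra c solution
      solution-isSol = ⊕-homomorphism⇒solution (!-hom ⊕-coalgebra) h∘inr≈id

      solution-unique : (s : X ⇒ T) → IsSolution algebra c s → s ≈ solution
      solution-unique s p =
        ≈-trans (≈-sym inject₁) (!-unique ⊕-coalgebra [ s , id ] (solution⇒⊕-homomorphism p) ⟩∘⟨refl)

  -- Free algebras on Y yield final coalgebras for H(-) + Y

  module OneLayer {Y : Obj} (B : CompleteElgot) (η : Y ⇒ Carrier B) where
    open CompleteElgot B
    open ElgotLaws B
    private
      T : Obj
      T = Alg.A alg
      τ : F₀ T ⇒ T
      τ = Alg.α alg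

    a : F₀ T + Y ⇒ T
    a = [ τ , η ]

    layered : Alg
    layered = record { A = F₀ T + Y ; α = inl ∘ F₁ a }

    layered-sol : ∀ {X} → X ⇒ F₀ X + (F₀ T + Y) → X ⇒ F₀ T + Y
    layered-sol c = [ inl ∘ F₁ ((a • c) †) , id ] ∘ c

    private
      a-rhs : ∀ {X} {c : X ⇒ F₀ X + (F₀ T + Y)} {x : X ⇒ T} →
              a ∘ [ inl ∘ F₁ x , id ] ∘ c ≈ [ τ , id ] ∘ (F₁ x +₁ id) ∘ (a • c)
      a-rhs = ≈-trans (pullˡ (≈-trans ∘-distribˡ-[] ([]-cong₂ (pullˡ inject₁) identityʳ))) (≈-sym solution-rhs-•)

      layered-rhs : ∀ {X} {c : X ⇒ F₀ X + (F₀ T + Y)} {s : X ⇒ F₀ T + Y} →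
                    [ inl ∘ F₁ a , id ] ∘ (F₁ s +₁ id) ∘ c ≈ [ inl ∘ F₁ (a ∘ s) , id ] ∘ c
      layered-rhs = ≈-trans solution-rhs ([]-cong₂ (pullʳ (≈-sym homomorphism)) ≈-refl ⟩∘⟨refl)

      [inl∘F₁-]∘F₁+₁ : ∀ {X X′} {S : X′ ⇒ T} {h : X ⇒ X′} →
                          [ inl ∘ F₁ S , id {F₀ T + Y} ] ∘ (F₁ h +₁ id) ≈ [ inl ∘ F₁ (S ∘ h) , id ]
      [inl∘F₁-]∘F₁+₁ = ≈-trans []∘+₁ ([]-cong₂ (pullʳ (≈-sym homomorphism)) identityˡ)

    a∘layered-sol : ∀ {X} (c : X ⇒ F₀ X + (F₀ T + Y)) → a ∘ layered-sol c ≈ (a • c) †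
    a∘layered-sol c = ≈-trans a-rhs (≈-sym (†-isSol _))

    layered-sol-isSol : ∀ {X} (c : X ⇒ F₀ X + (F₀ T + Y)) → IsSolution layered c (layered-sol c)
    layered-sol-isSol c =
      ≈-sym (≈-trans layered-rhs ([]-cong₂ (refl⟩∘⟨ F-resp-≈ (a∘layered-sol c)) ≈-refl ⟩∘⟨refl))

    layered-sol-unique : (∀ {X} (c : X ⇒ F₀ X + T) (s : X ⇒ T) → IsSolution alg c s → s ≈ c †) →
                         ∀ {X} (c : X ⇒ F₀ X + (F₀ T + Y)) (s : X ⇒ F₀ T + Y) →
                         IsSolution layered c s → s ≈ layered-sol c
    layered-sol-unique †-unique c s p =
      ≈-trans s≈ ([]-cong₂ (refl⟩∘⟨ F-resp-≈ a∘s≈) ≈-refl ⟩∘⟨refl)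
      where
        s≈ : s ≈ [ inl ∘ F₁ (a ∘ s) , id ] ∘ c
        s≈ = ≈-trans p layered-rhs
        a∘s≈ : a ∘ s ≈ (a • c) †
        a∘s≈ = †-unique (a • c) (a ∘ s) (≈-trans (refl⟩∘⟨ s≈) a-rhs)

    layered-sol-functorial : ∀ {X X′} (c : X ⇒ F₀ X + (F₀ T + Y)) (d : X′ ⇒ F₀ X′ + (F₀ T + Y))
                             (h : X ⇒ X′) → (F₁ h +₁ id) ∘ c ≈ d ∘ h → layered-sol c ≈ layered-sol d ∘ h
    layered-sol-functorial c d h p = begin
      [ inl ∘ F₁ ((a • c) †) , id ] ∘ c
        ≈⟨ []-cong₂ (refl⟩∘⟨ F-resp-≈ (†-•-natural p)) ≈-refl ⟩∘⟨refl ⟩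
      [ inl ∘ F₁ (((a • d) †) ∘ h) , id ] ∘ c            ≈⟨ pullˡ [inl∘F₁-]∘F₁+₁ ⟨
      [ inl ∘ F₁ ((a • d) †) , id ] ∘ (F₁ h +₁ id) ∘ c   ≈⟨ refl⟩∘⟨ p ⟩
      [ inl ∘ F₁ ((a • d) †) , id ] ∘ d ∘ h              ≈⟨ sym-assoc ⟩
      layered-sol d ∘ h                                  ∎

    layered-sol-compositional : ∀ {X Z} (c : X ⇒ F₀ X + Z) (f : Z ⇒ F₀ Z + (F₀ T + Y)) →
                                layered-sol (layered-sol f • c) ≈ layered-sol (f ⊕ c) ∘ inl
    layered-sol-compositional {X} {Z} c f = begin
      [ inl ∘ F₁ ((a • (layered-sol f • c)) †) , id ] ∘ (layered-sol f • c)
        ≈⟨ []-cong₂ (refl⟩∘⟨ F-resp-≈ S∘inl) ≈-refl ⟩∘⟨refl ⟩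
      [ inl ∘ F₁ (S ∘ inl) , id ] ∘ (layered-sol f • c)
        ≈⟨ pullˡ (≈-trans []∘+₁ ([]-cong₂ identityʳ identityˡ)) ⟩
      [ inl ∘ F₁ (S ∘ inl) , layered-sol f ] ∘ c
        ≈⟨ []-cong₂ ≈-refl S∘inr-solves-f ⟩∘⟨refl ⟨
      [ inl ∘ F₁ (S ∘ inl) , [ inl , id ] ∘ (F₁ (S ∘ inr) +₁ id) ∘ f ] ∘ c
        ≈⟨ solution-rhs-⊕-inl ⟨
      [ inl , id ] ∘ (F₁ S +₁ id) ∘ (f ⊕ c) ∘ inl
        ≈⟨ solution-rhs ⟩
      [ inl ∘ F₁ S , id ] ∘ (f ⊕ c) ∘ inl
        ≈⟨ []-cong₂ (refl⟩∘⟨ F-resp-≈ (†-cong ⊕-•)) ≈-refl ⟩∘⟨refl ⟩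
      [ inl ∘ F₁ ((a • (f ⊕ c)) †) , id ] ∘ (f ⊕ c) ∘ inl
        ≈⟨ sym-assoc ⟩
      layered-sol (f ⊕ c) ∘ inl
        ∎
      where
        S : X + Z ⇒ T
        S = ((a • f) ⊕ c) †
        S∘inl : (a • (layered-sol f • c)) † ≈ S ∘ inl
        S∘inl = ≈-trans (†-cong (≈-trans •-∘ (•-cong (a∘layered-sol f)))) (compositionality c (a • f))
        S∘inr≈ : S ∘ inr ≈ (a • f) †
        S∘inr≈ = ≈-sym (functoriality (a • f) ((a • f) ⊕ c) inr (≈-sym ⊕-inr))
        S∘inr-solves-f : [ inl , id ] ∘ (F₁ (S ∘ inr) +₁ id) ∘ f ≈ layered-sol f
        S∘inr-solves-f = ≈-trans solution-rhs ([]-cong₂ (refl⟩∘⟨ F-resp-≈ S∘inr≈) ≈-refl ⟩∘⟨refl)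

    layered-elgot : CompleteElgot
    layered-elgot = record
      { alg              = layered
      ; _†               = layered-sol
      ; †-isSol          = layered-sol-isSol
      ; functoriality    = layered-sol-functorial
      ; compositionality = layered-sol-compositional
      }

    a-preserves-solutions : IsSolutionPreserving layered-elgot B a
    a-preserves-solutions = a∘layered-sol

    a-homomorphism : IsAlgHom layered alg a
    a-homomorphism = pullˡ inject₁

    section⇒unfolding : {t : T ⇒ F₀ T + Y} → IsAlgHom alg layered t → t ∘ η ≈ inr → a ∘ t ≈ id → Unfolding Y
    section⇒unfolding {t} t-hom t∘η≈inr a∘t≈id = record
      { T    = T
      ; τ    = τ
      ; η    = η
      ; t    = t
      ; isoˡ = a∘t≈id
      ; isoʳ = +-ext t∘a∘inl (≈-trans (pullʳ inject₂) (≈-trans t∘η≈inr (≈-sym identityˡ)))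
      }
      where
        t∘a∘inl : (t ∘ a) ∘ inl ≈ id ∘ inl
        t∘a∘inl = begin
          (t ∘ a) ∘ inl         ≈⟨ pullʳ inject₁ ⟩
          t ∘ τ                 ≈⟨ t-hom ⟩
          (inl ∘ F₁ a) ∘ F₁ t   ≈⟨ pullʳ (≈-sym homomorphism) ⟩
          inl ∘ F₁ (a ∘ t)      ≈⟨ refl⟩∘⟨ ≈-trans (F-resp-≈ a∘t≈id) identity ⟩
          inl ∘ id              ≈⟨ id-comm ⟩
          id ∘ inl              ∎

  module FreeCIAProperties {Y : Obj} (FF : FreeCIA Y) where
    open FreeCIA FF
    open OneLayer (CIA⇒CompleteElgot T) η

    layered-cia : CIA
    layered-cia = record
      { alg        = layered
      ; sol        = layered-sol
      ; sol-isSol  = layered-sol-isSol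
      ; sol-unique = layered-sol-unique (CIA.sol-unique T)
      }

    lambek : Unfolding Y
    lambek = section⇒unfolding (ext-hom layered-cia inr) (ext-η layered-cia inr) a∘t≈id
      where
        t : Alg.A (CIA.alg T) ⇒ F₀ (Alg.A (CIA.alg T)) + Y
        t = ext layered-cia inr
        a∘t≈id : a ∘ t ≈ id
        a∘t≈id = ≈-trans
          (ext-unique T η (a ∘ t) (∘-homomorphism _ _ _ a-homomorphism (ext-hom layered-cia inr))
                                  (≈-trans (pullʳ (ext-η layered-cia inr)) inject₂))
          (≈-sym (ext-unique T η id (id-homomorphism _) identityˡ))

    final : FinalCoalgebra Y
    final = UnfoldingProperties.final lambek (CIA.sol T) (CIA.sol-isSol T) (λ c h → CIA.sol-unique T _ h)

  module FreeElgotProperties {Y : Obj} (FE : FreeCompleteElgot Y) where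
    open FreeCompleteElgot FE
    open OneLayer T η
    open CompleteElgot T
    open ElgotLaws T

    private
      t : Carrier T ⇒ F₀ (Carrier T) + Y
      t = ext layered-elgot inr
      t-sp : IsSolutionPreserving T layered-elgot t
      t-sp = ext-sp layered-elgot inr

      id≈ext-η : id ≈ ext T η
      id≈ext-η = ext-unique T η id (id-preserves-solutions T) identityˡ

    lambek : Unfolding Y
    lambek = section⇒unfolding (solution-preserving⇒homomorphism T layered-elgot t-sp)
                               (ext-η layered-elgot inr) a∘t≈id
      where
        a∘t≈id : a ∘ t ≈ id
        a∘t≈id = ≈-trans
          (ext-unique T η (a ∘ t) (∘-preserves-solutions T layered-elgot T a-preserves-solutions t-sp)
                                  (≈-trans (pullʳ (ext-η layered-elgot inr)) inject₂))
          (≈-sym id≈ext-η)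

    open UnfoldingProperties lambek
      using (algebra; solution⇒extension; solution⇒coalgebra-homomorphism; extension-preserves-solutions)

    η•t-†≈id : (η • t) † ≈ id
    η•t-†≈id = ≈-trans
      (ext-unique T η _ (λ c → extension-preserves-solutions T η (†-isSol c))
                        (proj₂ (solution⇒extension algebra (†-isSol _))))
      (≈-sym id≈ext-η)

    η•-†-unique : ∀ {X} (c : X ⇒ F₀ X + Y) (h : X ⇒ Carrier T) → IsSolution algebra (η • c) h → h ≈ (η • c) †
    η•-†-unique c h p = ≈-sym (begin
      (η • c) †          ≈⟨ †-•-natural (solution⇒coalgebra-homomorphism p) ⟩
      ((η • t) †) ∘ h    ≈⟨ η•t-†≈id ⟩∘⟨refl ⟩
      id ∘ h             ≈⟨ identityˡ ⟩
      h                  ∎)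

    final : FinalCoalgebra Y
    final = UnfoldingProperties.final lambek _† †-isSol η•-†-unique

  Cond1⇒Cond2 : Cond1 → Cond2
  Cond1⇒Cond2 final Y = UnfoldingProperties.free-cia lambek solution solution-isSol solution-unique
    where open FinalCoalgebraProperties (final Y)

  Cond1⇒Cond3 : Cond1 → Cond3
  Cond1⇒Cond3 final Y = UnfoldingProperties.free-complete-elgot lambek solution solution-isSol solution-unique
    where open FinalCoalgebraProperties (final Y)

  Cond2⇒Cond1 : Cond2 → Cond1
  Cond2⇒Cond1 free Y = FreeCIAProperties.final (free Y)

  Cond3⇒Cond1 : Cond3 → Cond1
  Cond3⇒Cond1 free Y = FreeElgotProperties.final (free Y)

  Cond2⇒Cond3 : Cond2 → Cond3
  Cond2⇒Cond3 free = Cond1⇒Cond3 (Cond2⇒Cond1 free)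

  Cond3⇒Cond2 : Cond3 → Cond2
  Cond3⇒Cond2 free = Cond1⇒Cond2 (Cond3⇒Cond1 free)

corollary5p7 : ∀ {o ℓ e} (C : Category o ℓ e) (FC : FiniteCoproducts C)
               (H : Endofunctor C) →
               (Theory.Cond1 FC H ⇔ Theory.Cond2 FC H)
               × (Theory.Cond2 FC H ⇔ Theory.Cond3 FC H)
corollary5p7 C FC H =
  mk⇔ (Cond1⇒Cond2 FC H) (Cond2⇒Cond1 FC H) , mk⇔ (Cond2⇒Cond3 FC H) (Cond3⇒Cond2 FC H)
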